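{- Let $n\ge 6$, let $x,y\in\{0,1\}^{n-1}$ and $\beta\in\{0,1\}$. If $$\begin{bmatrix} T_{n-1}&x\\ y^T&\beta\end{bmatrix}\in\Gamma(n,n-2)$$ and $f(x)+f(y)+\beta=n-2$, then one of the following holds: (1) $x=(1,\dots,1,0)^T$, $y=0$ and $\beta=0$; (2) $y=(0,1,\dots,1)^T$, $x=0$ and $\beta=0$.
   Context: $T_{n-1}$ is the $(n-1)\times(n-1)$ matrix with $(i,j)$-entry $1$ if $i<j$ and $0$ otherwise. For a $0$-$1$ vector $v$, $f(v)$ is its number of entries equal to $1$. $\Gamma(n,k)$ is the set of $n\times n$ $0$-$1$ matrices $A$ such that every entry of the (integer) matrix power $A^k$ is $0$ or $1$. -}

module Defs where

open import Data.Nat using (ℕ; zero; suc; _+_; _*_; _<_; _≤_)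
open import Data.Nat.Properties using (_<?_)
open import Data.Fin using (Fin; toℕ; fromℕ<)
open import Data.Bool using (Bool; true; false)
open import Data.Vec.Functional using (Vector)
open import Data.List using (List; map; allFin)
open import Data.Nat.ListAction using (sum)
open import Relation.Nullary using (yes; no)

Matrix : ℕ → Set
Matrix n = Fin n → Fin n → ℕ

BVec : ℕ → Set
BVec n = Vector Bool n

b2n : Bool → ℕ
b2n true  = 1
b2n false = 0

f : ∀ {n} → BVec n → ℕ
f {n} v = sum (map (λ i → b2n (v i)) (allFin n))

_⊗_ : ∀ {n} → Matrix n → Matrix n → Matrix n
_⊗_ {n} A B i j = sum (map (λ k → A i k * B k j) (allFin n))

identity : ∀ {n} → Matrix n
identity i j with toℕ i Data.Nat.≟ toℕ j
... | yes _ = 1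
... | no _  = 0

_^ᴹ_ : ∀ {n} → Matrix n → ℕ → Matrix n
A ^ᴹ zero  = identity
A ^ᴹ suc k = A ⊗ (A ^ᴹ k)

BMatrix : ℕ → Set
BMatrix n = Fin n → Fin n → Bool

toℕMat : ∀ {n} → BMatrix n → Matrix n
toℕMat A i j = b2n (A i j)

Γ : (n k : ℕ) → BMatrix n → Set
Γ n k A = ∀ i j → (toℕMat A ^ᴹ k) i j ≤ 1

T : (m : ℕ) → BMatrix m
T m i j with toℕ i <? toℕ j
... | yes _ = true
... | no _  = false

-- block matrix [[T_m, x],[y^T, β]] of size (m+1)×(m+1);
-- an index i : Fin (suc m) with toℕ i < m is a "top/left" index, otherwise it is the last index m
block : (m : ℕ) → BVec m → BVec m → Bool → BMatrix (suc m)
block m x y β i j with toℕ i <? m | toℕ j <? m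
... | yes i<m | yes j<m = T m (fromℕ< i<m) (fromℕ< j<m)
... | yes i<m | no _    = x (fromℕ< i<m)
... | no _    | yes j<m = y (fromℕ< j<m)
... | no _    | no _    = β

zeroV : ∀ {m} → BVec m
zeroV _ = false

onesThenZero : ∀ {m} → BVec m
onesThenZero {m} i with suc (toℕ i) <? m
... | yes _ = true
... | no _  = false

zeroThenOnes : ∀ {m} → BVec m
zeroThenOnes i with 0 <? toℕ i
... | yes _ = true
... | no _  = false

module Submission where

open import Defs
open import Data.Nat using (ℕ; zero; suc; _+_; _*_; _≤_; _<_; _∸_; z≤n; s≤s; s≤s⁻¹; z<s; s<s)
open import Data.Nat.Properties
open import Data.Bool using (Bool; true; false)
open import Data.Bool.Properties using (¬-not)
open import Data.Fin using (Fin; toℕ; fromℕ<) renaming (zero to fzero; suc to fsuc)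
open import Data.Fin.Properties using (toℕ-fromℕ<; fromℕ<-toℕ; toℕ<n; toℕ-injective)
open import Data.List using (map; allFin)
open import Data.List.Properties using (map-tabulate)
open import Data.Nat.ListAction using (sum)
open import Data.Product using (_×_; _,_; ∃-syntax)
open import Data.Sum using (_⊎_; inj₁; inj₂; [_,_]′)
open import Data.Empty using (⊥; ⊥-elim)
open import Function using (_∘_)
open import Algebra.Properties.CommutativeSemigroup +-commutativeSemigroup using (x∙yz≈y∙xz)
open import Relation.Nullary using (yes; no; ¬_)
open import Relation.Binary.PropositionalEquality

-- The entries of A^k count walks of length k = n − 2 in the digraph on 0, …, n − 1 with arcs
-- i → j for i < j < n − 1, a → v when x_a = 1, v → b when y_b = 1, and a loop at v = n − 1 when
-- β = 1. So A ∈ Γ(n, n − 2) forbids two distinct walks of length k with common ends. The straight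
-- walk 0 → 1 → ⋯ → n − 2 has length k, hence no walk of length k from 0 to n − 2 passes through v.
-- If β = 1 the loop pads any a ∈ x, b ∈ y into such a detour, and two entries of x (or of y) give
-- two walks into (out of) v; so f(x) + f(y) ≤ 1. If β = 0 and f(x) + f(y) = n − 2 while both are
-- nonzero, counting yields a ∈ x, b ∈ y with b ≤ a + 2, which is exactly what a detour of length k
-- needs; so x = 0 or y = 0. Finally x_{n−2} = 1 would give the two walks 0 → 1 ⇝ n − 2 → v and
-- 0 → 2 ⇝ n − 2 → v (dually for y_0), and the count f = n − 2 forces the remaining entries.

sumFin : ∀ k → (Fin k → ℕ) → ℕ
sumFin k g = sum (map g (allFin k))

sumFin-suc : ∀ k (g : Fin (suc k) → ℕ) → sumFin (suc k) g ≡ g fzero + sumFin k (g ∘ fsuc)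
sumFin-suc k g = cong (λ gs → g fzero + sum gs)
  (trans (map-tabulate fsuc g) (sym (map-tabulate (λ i → i) (g ∘ fsuc))))

term≤sumFin : ∀ {k} (g : Fin k → ℕ) l → g l ≤ sumFin k g
term≤sumFin {suc k} g fzero rewrite sumFin-suc k g = m≤m+n _ _
term≤sumFin {suc k} g (fsuc l) rewrite sumFin-suc k g =
  ≤-trans (term≤sumFin (g ∘ fsuc) l) (m≤n+m _ _)

two-terms≤sumFin : ∀ {k} (g : Fin k → ℕ) {l₁ l₂} → l₁ ≢ l₂ → g l₁ + g l₂ ≤ sumFin k g
two-terms≤sumFin {suc k} g {fzero} {fzero} l₁≢l₂ = ⊥-elim (l₁≢l₂ refl)
two-terms≤sumFin {suc k} g {fzero} {fsuc l₂} _ rewrite sumFin-suc k g =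
  +-monoʳ-≤ (g fzero) (term≤sumFin (g ∘ fsuc) l₂)
two-terms≤sumFin {suc k} g {fsuc l₁} {fzero} _ rewrite sumFin-suc k g | +-comm (g (fsuc l₁)) (g fzero) =
  +-monoʳ-≤ (g fzero) (term≤sumFin (g ∘ fsuc) l₁)
two-terms≤sumFin {suc k} g {fsuc l₁} {fsuc l₂} l₁≢l₂ rewrite sumFin-suc k g =
  ≤-trans (two-terms≤sumFin (g ∘ fsuc) (l₁≢l₂ ∘ cong fsuc)) (m≤n+m _ _)

identity-diag : ∀ {N} (i : Fin N) → identity i i ≡ 1
identity-diag i with toℕ i ≟ toℕ i
... | yes _ = refl
... | no i≢i = ⊥-elim (i≢i refl)

≡1⇒*-identityˡ : ∀ {a} b → a ≡ 1 → a * b ≡ b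
≡1⇒*-identityˡ b refl = *-identityˡ b

^ᴹ-suc-≥ : ∀ {N} (A : Matrix N) k {i l j} → A i l ≡ 1 → (A ^ᴹ k) l j ≤ (A ^ᴹ suc k) i j
^ᴹ-suc-≥ A k {i} {l} {j} Ail≡1 =
  subst (_≤ (A ^ᴹ suc k) i j) (≡1⇒*-identityˡ _ Ail≡1)
    (term≤sumFin (λ l → A i l * (A ^ᴹ k) l j) l)

^ᴹ-suc-≥₂ : ∀ {N} (A : Matrix N) k {i l₁ l₂ j} → A i l₁ ≡ 1 → A i l₂ ≡ 1 → l₁ ≢ l₂ →
            (A ^ᴹ k) l₁ j + (A ^ᴹ k) l₂ j ≤ (A ^ᴹ suc k) i j
^ᴹ-suc-≥₂ A k {i} {l₁} {l₂} {j} Ail₁≡1 Ail₂≡1 l₁≢l₂ =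
  subst (_≤ (A ^ᴹ suc k) i j) (cong₂ _+_ (≡1⇒*-identityˡ _ Ail₁≡1) (≡1⇒*-identityˡ _ Ail₂≡1))
    (two-terms≤sumFin (λ l → A i l * (A ^ᴹ k) l j) l₁≢l₂)

module Walks {m : ℕ} (B : BMatrix (suc m)) (E : ℕ → ℕ → Bool)
             (B≡E : ∀ i j → B i j ≡ E (toℕ i) (toℕ j)) where

  data Walk : ℕ → ℕ → ℕ → Set where
    [_]  : ∀ {a} → a ≤ m → Walk 0 a a
    step : ∀ {k a c b} → E a c ≡ true → c ≤ m → Walk k c b → Walk (suc k) a b

  -- Two distinct walks with common ends, recorded at the step where they first diverge.
  data Fork : ℕ → ℕ → ℕ → Set where
    fork   : ∀ {k a c₁ c₂ b} → E a c₁ ≡ true → E a c₂ ≡ true → c₁ ≢ c₂ → c₁ ≤ m → c₂ ≤ m →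
             Walk k c₁ b → Walk k c₂ b → Fork (suc k) a b
    shared : ∀ {k a c b} → E a c ≡ true → c ≤ m → Fork k c b → Fork (suc k) a b

  _++_ : ∀ {k₁ k₂ a c b} → Walk k₁ a c → Walk k₂ c b → Walk (k₁ + k₂) a b
  [ _ ]        ++ q = q
  step e c≤m p ++ q = step e c≤m (p ++ q)

  snoc : ∀ {k a c b} → Walk k a c → E c b ≡ true → b ≤ m → Walk (suc k) a b
  snoc [ _ ]            e b≤m = step e b≤m [ b≤m ]
  snoc (step e′ c≤m p) e b≤m = step e′ c≤m (snoc p e b≤m)

  fork-snoc : ∀ {k a c b} → Fork k a c → E c b ≡ true → b ≤ m → Fork (suc k) a b
  fork-snoc (fork e₁ e₂ c₁≢c₂ c₁≤m c₂≤m p₁ p₂) e b≤m =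
    fork e₁ e₂ c₁≢c₂ c₁≤m c₂≤m (snoc p₁ e b≤m) (snoc p₂ e b≤m)
  fork-snoc (shared e′ c≤m d)                  e b≤m = shared e′ c≤m (fork-snoc d e b≤m)

  loops : ∀ {a} → E a a ≡ true → a ≤ m → ∀ L → Walk L a a
  loops e a≤m zero    = [ a≤m ]
  loops e a≤m (suc L) = step e a≤m (loops e a≤m L)

  loops-fork : ∀ {k a b} → E a a ≡ true → a ≤ m → ∀ L → Fork k a b → Fork (L + k) a b
  loops-fork e a≤m zero    d = d
  loops-fork e a≤m (suc L) d = shared e a≤m (loops-fork e a≤m L d)

  _visits_ : ∀ {k a b} → Walk k a b → ℕ → Set
  ([_] {a} _)          visits w = a ≡ w
  (step {a = a} _ _ p) visits w = a ≡ w ⊎ p visits w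

  visits-start : ∀ {k a b} (p : Walk k a b) → p visits a
  visits-start [ _ ]        = refl
  visits-start (step _ _ _) = inj₁ refl

  ++-visitsʳ : ∀ {k₁ k₂ a c b} (p : Walk k₁ a c) (q : Walk k₂ c b) {w} → q visits w → (p ++ q) visits w
  ++-visitsʳ [ _ ]        q v = v
  ++-visitsʳ (step _ _ p) q v = inj₂ (++-visitsʳ p q v)

  separated⇒fork : ∀ {k a b} (p q : Walk k a b) {w} → ¬ p visits w → q visits w → Fork k a b
  separated⇒fork [ _ ] [ _ ] ¬v v = ⊥-elim (¬v v)
  separated⇒fork (step {c = c₁} e₁ c₁≤m p) (step {c = c₂} e₂ c₂≤m q) ¬v v with c₁ ≟ c₂
  ... | no c₁≢c₂ = fork e₁ e₂ c₁≢c₂ c₁≤m c₂≤m p q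
  separated⇒fork (step e₁ c₁≤m p) (step e₂ c₂≤m q) ¬v (inj₁ a≡w) | yes refl = ⊥-elim (¬v (inj₁ a≡w))
  separated⇒fork (step e₁ c₁≤m p) (step e₂ c₂≤m q) ¬v (inj₂ v)   | yes refl =
    shared e₁ c₁≤m (separated⇒fork p q (¬v ∘ inj₂) v)

  A : Matrix (suc m)
  A = toℕMat B

  vertex : ∀ {a} → a ≤ m → Fin (suc m)
  vertex a≤m = fromℕ< (s≤s a≤m)

  toℕ-vertex : ∀ {a} (a≤m : a ≤ m) → toℕ (vertex a≤m) ≡ a
  toℕ-vertex a≤m = toℕ-fromℕ< (s≤s a≤m)

  edge⇒entry≡1 : ∀ {i l a c} → toℕ i ≡ a → toℕ l ≡ c → E a c ≡ true → A i l ≡ 1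
  edge⇒entry≡1 {i} {l} refl refl e = cong b2n (trans (B≡E i l) e)

  walk⇒1≤^ᴹ : ∀ {k a b} → Walk k a b → ∀ {i j} → toℕ i ≡ a → toℕ j ≡ b → 1 ≤ (A ^ᴹ k) i j
  walk⇒1≤^ᴹ [ _ ] {i} {j} i≡a j≡a
    rewrite toℕ-injective (trans j≡a (sym i≡a)) = ≤-reflexive (sym (identity-diag i))
  walk⇒1≤^ᴹ (step {k} e c≤m p) i≡a j≡b =
    ≤-trans (walk⇒1≤^ᴹ p (toℕ-vertex c≤m) j≡b) (^ᴹ-suc-≥ A k (edge⇒entry≡1 i≡a (toℕ-vertex c≤m) e))

  fork⇒2≤^ᴹ : ∀ {k a b} → Fork k a b → ∀ {i j} → toℕ i ≡ a → toℕ j ≡ b → 2 ≤ (A ^ᴹ k) i j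
  fork⇒2≤^ᴹ (fork {k} e₁ e₂ c₁≢c₂ c₁≤m c₂≤m p₁ p₂) i≡a j≡b =
    ≤-trans (+-mono-≤ (walk⇒1≤^ᴹ p₁ (toℕ-vertex c₁≤m) j≡b) (walk⇒1≤^ᴹ p₂ (toℕ-vertex c₂≤m) j≡b))
      (^ᴹ-suc-≥₂ A k (edge⇒entry≡1 i≡a (toℕ-vertex c₁≤m) e₁) (edge⇒entry≡1 i≡a (toℕ-vertex c₂≤m) e₂)
        (λ l₁≡l₂ → c₁≢c₂ (trans (sym (toℕ-vertex c₁≤m)) (trans (cong toℕ l₁≡l₂) (toℕ-vertex c₂≤m)))))
  fork⇒2≤^ᴹ (shared {k} e c≤m d) i≡a j≡b =
    ≤-trans (fork⇒2≤^ᴹ d (toℕ-vertex c≤m) j≡b) (^ᴹ-suc-≥ A k (edge⇒entry≡1 i≡a (toℕ-vertex c≤m) e))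

  Γ⇒¬Fork : ∀ {k a b} → Γ (suc m) k B → Fork k a b → a ≤ m → b ≤ m → ⊥
  Γ⇒¬Fork entries≤1 d a≤m b≤m =
    ≤⇒≯ (entries≤1 (vertex a≤m) (vertex b≤m)) (fork⇒2≤^ᴹ d (toℕ-vertex a≤m) (toℕ-vertex b≤m))

one-is-zero : ∀ a b → (0 < a → 0 < b → ⊥) → a ≡ 0 ⊎ b ≡ 0
one-is-zero zero    _       _    = inj₁ refl
one-is-zero (suc _) zero    _    = inj₂ refl
one-is-zero (suc _) (suc _) ¬0<× = ⊥-elim (¬0<× z<s z<s)

count : (ℕ → Bool) → ℕ → ℕ
count X zero    = 0
count X (suc k) = b2n (X k) + count X k

count≤ : ∀ X k → count X k ≤ k
count≤ X zero = z≤n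
count≤ X (suc k) with X k
... | true  = s≤s (count≤ X k)
... | false = m≤n⇒m≤1+n (count≤ X k)

count-unfoldˡ : ∀ X k → count X (suc k) ≡ b2n (X 0) + count (X ∘ suc) k
count-unfoldˡ X zero    = refl
count-unfoldˡ X (suc k) =
  trans (cong (b2n (X (suc k)) +_) (count-unfoldˡ X k))
        (x∙yz≈y∙xz (b2n (X (suc k))) (b2n (X 0)) (count (X ∘ suc) k))

count>0⇒∃ : ∀ X k → 0 < count X k → ∃[ a ] a < k × X a ≡ true
count>0⇒∃ X (suc k) 0<c with X k in Xk
... | true  = k , ≤-refl , Xk
... | false with count>0⇒∃ X k 0<c
... | a , a<k , Xa = a , m<n⇒m<1+n a<k , Xa

count>1⇒∃₂ : ∀ X k → 1 < count X k → ∃[ a₁ ] ∃[ a₂ ] a₁ < a₂ × a₂ < k × X a₁ ≡ true × X a₂ ≡ true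
count>1⇒∃₂ X (suc k) 1<c with X k in Xk
... | true with count>0⇒∃ X k (s≤s⁻¹ 1<c)
... | a , a<k , Xa = a , k , a<k , ≤-refl , Xa , Xk
count>1⇒∃₂ X (suc k) 1<c | false with count>1⇒∃₂ X k 1<c
... | a₁ , a₂ , a₁<a₂ , a₂<k , Xa₁ , Xa₂ = a₁ , a₂ , a₁<a₂ , m<n⇒m<1+n a₂<k , Xa₁ , Xa₂

count≡bound⇒all : ∀ X k → count X k ≡ k → ∀ {a} → a < k → X a ≡ true
count≡bound⇒all X (suc k) c≡k a<k with X k in Xk
... | false = ⊥-elim (<-irrefl refl (subst (_≤ k) c≡k (count≤ X k)))
... | true with m<1+n⇒m<n∨m≡n a<k
... | inj₁ a<k′ = count≡bound⇒all X k (suc-injective c≡k) a<k′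
... | inj₂ refl = Xk

count≡0⇒none : ∀ X k → count X k ≡ 0 → ∀ {a} → a < k → X a ≡ false
count≡0⇒none X (suc k) c≡0 a<k with X k in Xk
count≡0⇒none X (suc k) () a<k | true
... | false with m<1+n⇒m<n∨m≡n a<k
... | inj₁ a<k′ = count≡0⇒none X k c≡0 a<k′
... | inj₂ refl = Xk

no-two⇒count≤1 : ∀ X k → (∀ {a₁ a₂} → a₁ < a₂ → a₂ < k → X a₁ ≡ true → X a₂ ≡ true → ⊥) → count X k ≤ 1
no-two⇒count≤1 X k ¬two = ≮⇒≥ λ 1<count →
  let (_ , _ , a₁<a₂ , a₂<k , Xa₁ , Xa₂) = count>1⇒∃₂ X k 1<count in ¬two a₁<a₂ a₂<k Xa₁ Xa₂

∃-near-top : ∀ X k → 0 < count X k → k ≤ suc (count X k) → ∃[ a ] a < k × X a ≡ true × k ≤ 2 + a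
∃-near-top X (suc zero) 0<c _ with count>0⇒∃ X 1 0<c
... | a , a<1 , Xa = a , a<1 , Xa , s≤s z≤n
∃-near-top X (suc (suc k)) 0<c k≤ with X (suc k) in Xk₁ | X k in Xk
... | true  | _     = suc k , ≤-refl , Xk₁ , n≤1+n _
... | false | true  = k , m<n⇒m<1+n ≤-refl , Xk , ≤-refl
... | false | false = ⊥-elim (<⇒≱ (s≤s⁻¹ k≤) (count≤ X k))

close-pair : ∀ X Y k → 0 < count X k → 0 < count Y k → k ≤ suc (count X k + count Y k) →
             ∃[ a ] ∃[ b ] a < k × b < k × X a ≡ true × Y b ≡ true × b ≤ 2 + a
close-pair X Y (suc k) 0<cX 0<cY k≤ with X k in Xk | Y k in Yk
... | true  | true  = k , k , ≤-refl , ≤-refl , Xk , Yk , m≤n+m k 2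
... | true  | false with count>0⇒∃ Y k 0<cY
... | b , b<k , Yb = k , b , ≤-refl , m<n⇒m<1+n b<k , Xk , Yb , ≤-trans (<⇒≤ b<k) (m≤n+m k 2)
close-pair X Y (suc k) 0<cX 0<cY k≤ | false | false
  with close-pair X Y k 0<cX 0<cY (≤-trans (n≤1+n k) k≤)
... | a , b , a<k , b<k , Xa , Yb , b≤ = a , b , m<n⇒m<1+n a<k , m<n⇒m<1+n b<k , Xa , Yb , b≤
close-pair X Y (suc k) 0<cX 0<cY k≤ | false | true with count Y k ≟ 0
... | no cY≢0 with close-pair X Y k 0<cX (n≢0⇒n>0 cY≢0) (subst (k ≤_) (+-suc (count X k) _) (s≤s⁻¹ k≤))
... | a , b , a<k , b<k , Xa , Yb , b≤ = a , b , m<n⇒m<1+n a<k , m<n⇒m<1+n b<k , Xa , Yb , b≤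
close-pair X Y (suc k) 0<cX 0<cY k≤ | false | true | yes cY≡0
  with ∃-near-top X k 0<cX (subst (k ≤_) (trans (cong (count X k +_) (cong suc cY≡0)) (+-comm _ 1)) (s≤s⁻¹ k≤))
... | a , a<k , Xa , k≤2+a = a , k , m<n⇒m<1+n a<k , ≤-refl , Xa , Yk , k≤2+a

at : ∀ {k} → BVec k → ℕ → Bool
at {k} v a with a <? k
... | yes a<k = v (fromℕ< a<k)
... | no _    = false

at-toℕ : ∀ {k} (v : BVec k) i → at v (toℕ i) ≡ v i
at-toℕ {k} v i with toℕ i <? k
... | yes i<k = cong v (fromℕ<-toℕ i i<k)
... | no i≮k  = ⊥-elim (i≮k (toℕ<n i))

f≡count : ∀ {k} (v : BVec k) → f v ≡ count (at v) k
f≡count {k} v = sum-b2n≡count k v (at v) (λ i → sym (at-toℕ v i))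
  where
    sum-b2n≡count : ∀ k (h : BVec k) X → (∀ i → h i ≡ X (toℕ i)) → f h ≡ count X k
    sum-b2n≡count zero    h X h≗X = refl
    sum-b2n≡count (suc k) h X h≗X = begin
      f h                                        ≡⟨ sumFin-suc k (b2n ∘ h) ⟩
      b2n (h fzero) + f (h ∘ fsuc)               ≡⟨ cong₂ _+_ (cong b2n (h≗X fzero))
                                                      (sum-b2n≡count k (h ∘ fsuc) (X ∘ suc) (h≗X ∘ fsuc)) ⟩
      b2n (X 0) + count (X ∘ suc) k              ≡⟨ sym (count-unfoldˡ X k) ⟩
      count X (suc k)                            ∎
      where open ≡-Reasoning

f≡0⇒≗zeroV : ∀ {k} (v : BVec k) → f v ≡ 0 → ∀ i → v i ≡ zeroV i
f≡0⇒≗zeroV v fv≡0 i =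
  trans (sym (at-toℕ v i)) (count≡0⇒none (at v) _ (trans (sym (f≡count v)) fv≡0) (toℕ<n i))

f≡k⇒≗onesThenZero : ∀ {k} (v : BVec (suc k)) → f v ≡ k → at v k ≡ false → ∀ i → v i ≡ onesThenZero i
f≡k⇒≗onesThenZero {k} v fv≡k vk≡false i with suc (toℕ i) <? suc k
... | yes i<k = trans (sym (at-toℕ v i)) (count≡bound⇒all (at v) k count≡k (s≤s⁻¹ i<k))
  where
    count≡k : count (at v) k ≡ k
    count≡k = trans (sym (cong (λ b → b2n b + count (at v) k) vk≡false)) (trans (sym (f≡count v)) fv≡k)
... | no i≮k = trans (sym (at-toℕ v i)) (subst (λ a → at v a ≡ false) (sym i≡k) vk≡false)
  where
    i≡k : toℕ i ≡ k
    i≡k = ≤-antisym (s≤s⁻¹ (toℕ<n i)) (s≤s⁻¹ (≮⇒≥ i≮k))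

f≡k⇒≗zeroThenOnes : ∀ {k} (v : BVec (suc k)) → f v ≡ k → at v 0 ≡ false → ∀ i → v i ≡ zeroThenOnes i
f≡k⇒≗zeroThenOnes {k} v fv≡k v0≡false fzero = trans (sym (at-toℕ v fzero)) v0≡false
f≡k⇒≗zeroThenOnes {k} v fv≡k v0≡false (fsuc i) =
  trans (sym (at-toℕ v (fsuc i))) (count≡bound⇒all (at v ∘ suc) k count≡k (toℕ<n i))
  where
    count≡k : count (at v ∘ suc) k ≡ k
    count≡k = begin
      count (at v ∘ suc) k                    ≡⟨ cong (λ b → b2n b + count (at v ∘ suc) k) (sym v0≡false) ⟩
      b2n (at v 0) + count (at v ∘ suc) k     ≡⟨ sym (count-unfoldˡ (at v) k) ⟩
      count (at v) (suc k)                    ≡⟨ sym (f≡count v) ⟩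
      f v                                     ≡⟨ fv≡k ⟩
      k                                       ∎
      where open ≡-Reasoning

-- Vertex m is the last row and column of the block matrix.
module BlockGraph (m : ℕ) (x y : BVec m) (β : Bool) where

  edge : ℕ → ℕ → Bool
  edge a c with a <? m | c <? m
  ... | yes a<m | yes c<m = T m (fromℕ< a<m) (fromℕ< c<m)
  ... | yes a<m | no _    = x (fromℕ< a<m)
  ... | no _    | yes c<m = y (fromℕ< c<m)
  ... | no _    | no _    = β

  block≡edge : ∀ i j → block m x y β i j ≡ edge (toℕ i) (toℕ j)
  block≡edge i j with toℕ i <? m | toℕ j <? m
  ... | yes _ | yes _ = refl
  ... | yes _ | no _  = refl
  ... | no _  | yes _ = refl
  ... | no _  | no _  = refl

  edge-< : ∀ {a c} → a < c → c < m → edge a c ≡ true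
  edge-< {a} {c} a<c c<m with a <? m | c <? m
  ... | no a≮m  | _       = ⊥-elim (a≮m (<-trans a<c c<m))
  ... | yes _   | no c≮m  = ⊥-elim (c≮m c<m)
  ... | yes a<m | yes c<m with toℕ (fromℕ< a<m) <? toℕ (fromℕ< c<m)
  ...   | yes _ = refl
  ...   | no ≮  = ⊥-elim (≮ (subst₂ _<_ (sym (toℕ-fromℕ< a<m)) (sym (toℕ-fromℕ< c<m)) a<c))

  edge-x : ∀ {a} → a < m → edge a m ≡ at x a
  edge-x {a} a<m with a <? m | m <? m
  ... | _       | yes m<m = ⊥-elim (<-irrefl refl m<m)
  ... | yes _   | no _    = refl
  ... | no a≮m  | no _    = ⊥-elim (a≮m a<m)

  edge-y : ∀ {b} → b < m → edge m b ≡ at y b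
  edge-y {b} b<m with m <? m | b <? m
  ... | yes m<m | _       = ⊥-elim (<-irrefl refl m<m)
  ... | no _    | yes _   = refl
  ... | no _    | no b≮m  = ⊥-elim (b≮m b<m)

  edge-loop : edge m m ≡ β
  edge-loop with m <? m
  ... | yes m<m = ⊥-elim (<-irrefl refl m<m)
  ... | no _    = refl

  open Walks (block m x y β) edge block≡edge public

  ascending : ∀ ℓ {a b} → b < m → a + ℓ ≤ b → (ℓ ≡ 0 → a ≡ b) → Walk ℓ a b
  ascending zero          b<m _ a≡b with a≡b refl
  ... | refl = [ <⇒≤ b<m ]
  ascending (suc zero) {a} {b} b<m a+1≤b _ =
    step (edge-< (subst (_≤ b) (+-comm a 1) a+1≤b) b<m) (<⇒≤ b<m) [ <⇒≤ b<m ]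
  ascending (suc (suc ℓ)) {a} {b} b<m a+ℓ+2≤b _ =
    step (edge-< (n<1+n a) 1+a<m) (<⇒≤ 1+a<m) (ascending (suc ℓ) b<m 1+a+ℓ+1≤b λ ())
    where
      1+a+ℓ+1≤b : suc a + suc ℓ ≤ b
      1+a+ℓ+1≤b = subst (_≤ b) (+-suc a (suc ℓ)) a+ℓ+2≤b
      1+a<m : suc a < m
      1+a<m = ≤-trans (≤-trans (≤-reflexive (+-comm 2 a)) (+-monoʳ-≤ a (s≤s (s≤s z≤n))))
                (≤-trans a+ℓ+2≤b (<⇒≤ b<m))

  ascending-visits≤ : ∀ ℓ {a b} (b<m : b < m) (a+ℓ≤b : a + ℓ ≤ b) (a≡b : ℓ ≡ 0 → a ≡ b) {w} →
                      ascending ℓ b<m a+ℓ≤b a≡b visits w → w ≤ b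
  ascending-visits≤ zero b<m _ a≡b v with a≡b refl
  ... | refl = ≤-reflexive (sym v)
  ascending-visits≤ (suc zero)    {a} _ a+1≤b _ (inj₁ refl) = ≤-trans (m≤m+n a 1) a+1≤b
  ascending-visits≤ (suc zero)        _ _     _ (inj₂ refl) = ≤-refl
  ascending-visits≤ (suc (suc ℓ)) {a} _ a+ℓ≤b _ (inj₁ refl) = ≤-trans (m≤m+n a _) a+ℓ≤b
  ascending-visits≤ (suc (suc ℓ))     b<m _   _ (inj₂ v)    = ascending-visits≤ (suc ℓ) b<m _ (λ ()) v

module Obstructions (n : ℕ) (x y : BVec (5 + n)) (β : Bool)
                    (entries≤1 : Γ (6 + n) (4 + n) (block (5 + n) x y β)) where

  open BlockGraph (5 + n) x y β

  -- Here the paper's n is 6 + n; k is both the exponent n − 2 and the last vertex of T_{n−1}.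
  m k : ℕ
  m = 5 + n
  k = 4 + n

  X Y : ℕ → Bool
  X = at x
  Y = at y

  k<m : k < m
  k<m = ≤-refl

  ¬Fork : ∀ {a b} → Fork k a b → a ≤ m → b ≤ m → ⊥
  ¬Fork = Γ⇒¬Fork entries≤1

  straight : Walk k 0 k
  straight = ascending k k<m ≤-refl (λ ())

  ¬detour : ∀ {ℓ} (p : Walk ℓ 0 k) → ℓ ≡ k → ¬ p visits m
  ¬detour p refl v = ¬Fork (separated⇒fork straight p avoids v) z≤n (<⇒≤ k<m)
    where
      avoids : ¬ straight visits m
      avoids v′ = <⇒≱ k<m (ascending-visits≤ k k<m ≤-refl (λ ()) v′)

  ¬pair-via-m : ∀ {a b ℓ₁ L ℓ₂} → a < m → X a ≡ true → b < m → Y b ≡ true →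
                Walk ℓ₁ 0 a → Walk L m m → Walk ℓ₂ b k → ℓ₁ + (L + ℓ₂) ≡ 2 + n → ⊥
  ¬pair-via-m {a} {b} {ℓ₁} {L} {ℓ₂} a<m Xa b<m Yb p r q ℓ≡ = ¬detour (p ++ m⇝k) length-k visits-m
    where
      m⇝k : Walk (suc (L + suc ℓ₂)) a k
      m⇝k = step (trans (edge-x a<m) Xa) ≤-refl (r ++ step (trans (edge-y b<m) Yb) (<⇒≤ b<m) q)
      visits-m : (p ++ m⇝k) visits m
      visits-m = ++-visitsʳ p m⇝k (inj₂ (visits-start _))
      length-k : ℓ₁ + suc (L + suc ℓ₂) ≡ k
      length-k = begin
        ℓ₁ + suc (L + suc ℓ₂)    ≡⟨ +-suc ℓ₁ _ ⟩
        suc (ℓ₁ + (L + suc ℓ₂))  ≡⟨ cong (λ t → suc (ℓ₁ + t)) (+-suc L ℓ₂) ⟩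
        suc (ℓ₁ + suc (L + ℓ₂))  ≡⟨ cong suc (+-suc ℓ₁ _) ⟩
        suc (suc (ℓ₁ + (L + ℓ₂))) ≡⟨ cong (suc ∘ suc) ℓ≡ ⟩
        k                        ∎
        where open ≡-Reasoning

  ¬pair-at-k : ∀ {a} → a < m → X a ≡ true → Y k ≡ true → 2 + n ≤ a → ⊥
  ¬pair-at-k a<m Xa Yk 2+n≤a = ¬pair-via-m a<m Xa k<m Yk
    (ascending (2 + n) a<m 2+n≤a (λ ())) [ ≤-refl ] [ <⇒≤ k<m ] (+-identityʳ _)

  ¬pair-near-start : ∀ {a b} → a < m → X a ≡ true → b < m → Y b ≡ true → b ≤ 2 + a → b < k → a ≤ suc n → ⊥
  ¬pair-near-start {a} {b} a<m Xa b<m Yb b≤2+a b<k a≤1+n = ¬pair-via-m a<m Xa b<m Yb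
    (ascending a a<m ≤-refl sym) [ ≤-refl ] (ascending (suc r) k<m b+r+1≤k (λ ())) a+r+1≡2+n
    where
      r : ℕ
      r = suc n ∸ a
      a+r+1≡2+n : a + suc r ≡ 2 + n
      a+r+1≡2+n = trans (+-suc a r) (cong suc (m+[n∸m]≡n a≤1+n))
      b+r+1≤k : b + suc r ≤ k
      b+r+1≤k = ≤-trans (+-monoˡ-≤ (suc r) b≤2+a) (≤-reflexive (cong (suc ∘ suc) a+r+1≡2+n))

  ¬pair-far-from-start : ∀ {a b} → a < m → X a ≡ true → b < m → Y b ≡ true → b < k → suc n < a → ⊥
  ¬pair-far-from-start {a} {b} a<m Xa b<m Yb b<k 1+n<a = ¬pair-via-m a<m Xa b<m Yb
    (ascending (suc n) a<m (<⇒≤ 1+n<a) (λ ())) [ ≤-refl ]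
    (ascending 1 k<m (subst (_≤ k) (+-comm 1 b) b<k) (λ ())) (+-comm (suc n) 1)

  ¬close-pair : ∀ {a b} → a < m → X a ≡ true → b < m → Y b ≡ true → b ≤ 2 + a → ⊥
  ¬close-pair {a} a<m Xa b<m Yb b≤2+a with m≤n⇒m<n∨m≡n (s≤s⁻¹ b<m) | ≤-<-connex a (suc n)
  ... | inj₂ refl | _          = ¬pair-at-k a<m Xa Yb (s≤s⁻¹ (s≤s⁻¹ b≤2+a))
  ... | inj₁ b<k  | inj₁ a≤1+n = ¬pair-near-start a<m Xa b<m Yb b≤2+a b<k a≤1+n
  ... | inj₁ b<k  | inj₂ 1+n<a = ¬pair-far-from-start a<m Xa b<m Yb b<k 1+n<a

  0⇉k : Fork (3 + n) 0 k
  0⇉k = fork (edge-< z<s 1<m) (edge-< z<s 2<m) (λ ()) (<⇒≤ 1<m) (<⇒≤ 2<m)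
          (ascending (2 + n) k<m (n≤1+n (3 + n)) (λ ())) (ascending (2 + n) k<m ≤-refl (λ ()))
    where
      1<m : 1 < m
      1<m = s<s z<s
      2<m : 2 < m
      2<m = s<s (s<s z<s)

  ¬x-last : X k ≢ true
  ¬x-last Xk = ¬Fork (fork-snoc 0⇉k (trans (edge-x k<m) Xk) ≤-refl) z≤n ≤-refl

  ¬y-first : Y 0 ≢ true
  ¬y-first Y0 = ¬Fork (shared (trans (edge-y z<s) Y0) z≤n 0⇉k) ≤-refl (<⇒≤ k<m)

  f>0⇒∃ : ∀ (v : BVec m) → 0 < f v → ∃[ a ] a < m × at v a ≡ true
  f>0⇒∃ v 0<fv = count>0⇒∃ (at v) m (subst (0 <_) (f≡count v) 0<fv)

  f≤1 : ∀ (v : BVec m) → (∀ {a₁ a₂} → a₁ < a₂ → a₂ < m → at v a₁ ≡ true → at v a₂ ≡ true → ⊥) → f v ≤ 1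
  f≤1 v ¬two = subst (_≤ 1) (sym (f≡count v)) (no-two⇒count≤1 (at v) m ¬two)

  one-side-empty : f x + f y ≡ 4 + n → f x ≡ 0 ⊎ f y ≡ 0
  one-side-empty fx+fy≡k = one-is-zero (f x) (f y) λ 0<fx 0<fy →
    let (_ , _ , a<m , b<m , Xa , Yb , b≤2+a) =
          close-pair X Y m (subst (0 <_) (f≡count x) 0<fx) (subst (0 <_) (f≡count y) 0<fy) m≤1+count
    in ¬close-pair a<m Xa b<m Yb b≤2+a
    where
      m≤1+count : m ≤ suc (count X m + count Y m)
      m≤1+count = ≤-reflexive (cong suc (trans (sym fx+fy≡k) (cong₂ _+_ (f≡count x) (f≡count y))))

  short-0⇝ : ∀ {a} → a < m → ∃[ t ] t ≤ 1 × Walk t 0 a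
  short-0⇝ {zero}  _   = 0 , z≤n , [ z≤n ]
  short-0⇝ {suc a} a<m = 1 , ≤-refl , ascending 1 a<m (s≤s z≤n) (λ ())

  short-⇝k : ∀ {b} → b < m → ∃[ t ] t ≤ 1 × Walk t b k
  short-⇝k b<m with m≤n⇒m<n∨m≡n (s≤s⁻¹ b<m)
  ... | inj₁ b<k  = 1 , ≤-refl , ascending 1 k<m (subst (_≤ k) (+-comm 1 _) b<k) (λ ())
  ... | inj₂ refl = 0 , z≤n , [ <⇒≤ k<m ]

  module Loop (β≡true : β ≡ true) where

    m→m : edge m m ≡ true
    m→m = trans edge-loop β≡true

    -- The loop at m absorbs whatever length the detour 0 ⇝ a → m → b ⇝ k falls short of k.
    ¬x×y : ∀ {a b} → a < m → X a ≡ true → b < m → Y b ≡ true → ⊥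
    ¬x×y {a} {b} a<m Xa b<m Yb with short-0⇝ a<m | short-⇝k b<m
    ... | t₁ , t₁≤1 , p | t₂ , t₂≤1 , q =
      ¬pair-via-m a<m Xa b<m Yb p (loops m→m ≤-refl L) q (begin
        t₁ + (L + t₂)  ≡⟨ x∙yz≈y∙xz t₁ L t₂ ⟩
        L + (t₁ + t₂)  ≡⟨ m∸n+n≡m t≤2+n ⟩
        2 + n          ∎)
      where
        open ≡-Reasoning
        t≤2+n : t₁ + t₂ ≤ 2 + n
        t≤2+n = ≤-trans (+-mono-≤ t₁≤1 t₂≤1) (m≤m+n 2 n)
        L : ℕ
        L = 2 + n ∸ (t₁ + t₂)

    ⇝m-looping : ∀ {a} → a < m → X a ≡ true → Walk (3 + n) a m
    ⇝m-looping a<m Xa = step (trans (edge-x a<m) Xa) ≤-refl (loops m→m ≤-refl (2 + n))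

    ¬two-x : ∀ {a₁ a₂} → a₁ < a₂ → a₂ < m → X a₁ ≡ true → X a₂ ≡ true → ⊥
    ¬two-x {zero} 0<a₂ a₂<m X0 Xa₂ =
      ¬Fork (fork (edge-< 0<a₂ a₂<m) (trans (edge-x (<-trans 0<a₂ a₂<m)) X0) (<⇒≢ a₂<m) (<⇒≤ a₂<m) ≤-refl
              (⇝m-looping a₂<m Xa₂) (loops m→m ≤-refl (3 + n)))
            z≤n ≤-refl
    ¬two-x {a₁@(suc _)} a₁<a₂ a₂<m Xa₁ Xa₂ =
      ¬Fork (fork (edge-< z<s a₁<m) (edge-< (<-trans z<s a₁<a₂) a₂<m) (<⇒≢ a₁<a₂) (<⇒≤ a₁<m) (<⇒≤ a₂<m)
              (⇝m-looping a₁<m Xa₁) (⇝m-looping a₂<m Xa₂))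
            z≤n ≤-refl
      where
        a₁<m : a₁ < m
        a₁<m = <-trans a₁<a₂ a₂<m

    y-pair-fork : ∀ {b₁ b₂} → b₁ < b₂ → b₂ < m → Y b₁ ≡ true → Y b₂ ≡ true → Fork 2 m k
    y-pair-fork {b₁} b₁<b₂ b₂<m Yb₁ Yb₂ with m≤n⇒m<n∨m≡n (s≤s⁻¹ b₂<m)
    ... | inj₁ b₂<k = fork (trans (edge-y b₁<m) Yb₁) (trans (edge-y b₂<m) Yb₂) (<⇒≢ b₁<b₂)
                        (<⇒≤ b₁<m) (<⇒≤ b₂<m) (⇝k b₁<k) (⇝k b₂<k)
      where
        b₁<m : b₁ < m
        b₁<m = <-trans b₁<b₂ b₂<m
        b₁<k : b₁ < k
        b₁<k = <-trans b₁<b₂ b₂<k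
        ⇝k : ∀ {b} → b < k → Walk 1 b k
        ⇝k b<k = ascending 1 k<m (subst (_≤ k) (+-comm 1 _) b<k) (λ ())
    ... | inj₂ refl = fork (trans (edge-y b₁<m) Yb₁) m→m (<⇒≢ b₁<m) (<⇒≤ b₁<m) ≤-refl
                        (ascending 1 k<m (subst (_≤ k) (+-comm 1 _) b₁<b₂) (λ ()))
                        (step (trans (edge-y k<m) Yb₂) (<⇒≤ k<m) [ <⇒≤ k<m ])
      where
        b₁<m : b₁ < m
        b₁<m = <-trans b₁<b₂ b₂<m

    ¬two-y : ∀ {b₁ b₂} → b₁ < b₂ → b₂ < m → Y b₁ ≡ true → Y b₂ ≡ true → ⊥
    ¬two-y b₁<b₂ b₂<m Yb₁ Yb₂ =
      ¬Fork (subst (λ ℓ → Fork ℓ m k) (+-comm (2 + n) 2)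
               (loops-fork m→m ≤-refl (2 + n) (y-pair-fork b₁<b₂ b₂<m Yb₁ Yb₂)))
            ≤-refl (<⇒≤ k<m)

    fx+fy≤1 : f x + f y ≤ 1
    fx+fy≤1 = [ (λ fx≡0 → subst (λ c → c + f y ≤ 1) (sym fx≡0) (f≤1 y ¬two-y))
              , (λ fy≡0 → subst (λ c → f x + c ≤ 1) (sym fy≡0)
                              (subst (_≤ 1) (sym (+-identityʳ _)) (f≤1 x ¬two-x)))
              ]′ (one-is-zero (f x) (f y) ¬both)
      where
        ¬both : 0 < f x → 0 < f y → ⊥
        ¬both 0<fx 0<fy = let (_ , a<m , Xa) = f>0⇒∃ x 0<fx ; (_ , b<m , Yb) = f>0⇒∃ y 0<fy
                          in ¬x×y a<m Xa b<m Yb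

  loop-free : f x + f y + b2n β ≡ 4 + n → β ≡ false
  loop-free fx+fy+β≡k = ¬-not λ β≡true →
    ≤⇒≯ (subst (_≤ 2) (subst (λ b → f x + f y + b2n b ≡ 4 + n) β≡true fx+fy+β≡k)
                      (+-monoˡ-≤ 1 (Loop.fx+fy≤1 β≡true)))
        (s≤s (s≤s (s≤s z≤n)))

corollary6 : (m : ℕ) → 6 ≤ suc m → (x y : BVec m) → (β : Bool) →
    Γ (suc m) (suc m ∸ 2) (block m x y β) →
    f x + f y + b2n β ≡ suc m ∸ 2 →
    ((∀ i → x i ≡ onesThenZero i) × (∀ i → y i ≡ zeroV i) × β ≡ false) ⊎
    ((∀ i → y i ≡ zeroThenOnes i) × (∀ i → x i ≡ zeroV i) × β ≡ false)
corollary6 .(5 + n) (s≤s (s≤s (s≤s (s≤s (s≤s (s≤s (z≤n {n}))))))) x y β entries≤1 fx+fy+β≡k =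
  [ (λ fx≡0 → inj₂ ( f≡k⇒≗zeroThenOnes y (trans (cong (_+ f y) (sym fx≡0)) fx+fy≡k) (¬-not ¬y-first)
                   , f≡0⇒≗zeroV x fx≡0 , β≡false))
  , (λ fy≡0 → inj₁ ( f≡k⇒≗onesThenZero x
                       (trans (sym (+-identityʳ (f x))) (trans (cong (f x +_) (sym fy≡0)) fx+fy≡k))
                       (¬-not ¬x-last)
                   , f≡0⇒≗zeroV y fy≡0 , β≡false))
  ]′ (one-side-empty fx+fy≡k)
  where
    open Obstructions n x y β entries≤1
    β≡false : β ≡ false
    β≡false = loop-free fx+fy+β≡k
    fx+fy≡k : f x + f y ≡ 4 + n
    fx+fy≡k = trans (sym (+-identityʳ _)) (subst (λ b → f x + f y + b2n b ≡ 4 + n) β≡false fx+fy+β≡k)
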